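{- If $G$ is an i-game, then $G+(-G)$ is an i-game and $L(G+(-G))=R(G+(-G))=0$.
   Context: Well-tempered $\mathbb{Z}$-valued games: an even-tempered game is an integer (a "number", with no options) or $\langle L\mid R\rangle$ with $L,R$ finite nonempty sets of odd-tempered games; an odd-tempered game is $\langle L\mid R\rangle$ with $L,R$ finite nonempty sets of even-tempered games. Outcomes: $L(n)=R(n)=n$ for numbers; otherwise $L(G)=\max_{G^L}R(G^L)$, $R(G)=\min_{G^R}L(G^R)$. Negation: $-n$ for numbers, $-\langle G^L\mid G^R\rangle=\langle -G^R\mid -G^L\rangle$. Sum: integer sum if both numbers, otherwise $G+H=\langle G^L+H, G+H^L\mid G^R+H, G+H^R\rangle$. An i-game is a game all of whose options are i-games and which, if even-tempered, satisfies $L(G)\ge R(G)$. -}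

module Defs where

open import Data.Integer using (ℤ; _⊔_; _⊓_; _≤_) renaming (_+_ to _+ℤ_; -_ to -ℤ_)
open import Data.List using (List; []; _∷_; _++_)
open import Data.List.NonEmpty using (List⁺; _∷_; toList; _⁺++⁺_)
open import Data.List.Relation.Unary.All using (All)
open import Data.Sum using (_⊎_)

-- A non-number game ⟨ L ∣ R ⟩ has
-- finite nonempty lists of Left and Right options (lists represent the finite
-- nonempty option sets; multiplicities/order are irrelevant to everything below).
data Game : Set where
  num   : ℤ → Game
  ⟨_∣_⟩ : List⁺ Game → List⁺ Game → Game

mutual
  data Even : Game → Set where
    even-num : ∀ n → Even (num n)
    even-opt : ∀ {ls rs} → All Odd (toList ls) → All Odd (toList rs) → Even ⟨ ls ∣ rs ⟩

  data Odd : Game → Set where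
    odd-opt : ∀ {ls rs} → All Even (toList ls) → All Even (toList rs) → Odd ⟨ ls ∣ rs ⟩

mutual
  Lo : Game → ℤ
  Lo (num n) = n
  Lo ⟨ x ∷ xs ∣ _ ⟩ = maxRo x xs

  Ro : Game → ℤ
  Ro (num n) = n
  Ro ⟨ _ ∣ x ∷ xs ⟩ = minLo x xs

  maxRo : Game → List Game → ℤ
  maxRo x [] = Ro x
  maxRo x (y ∷ ys) = Ro x ⊔ maxRo y ys

  minLo : Game → List Game → ℤ
  minLo x [] = Lo x
  minLo x (y ∷ ys) = Lo x ⊓ minLo y ys

mutual
  neg : Game → Game
  neg (num n) = num (-ℤ n)
  neg ⟨ ls ∣ rs ⟩ = ⟨ neg⁺ rs ∣ neg⁺ ls ⟩

  neg⁺ : List⁺ Game → List⁺ Game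
  neg⁺ (x ∷ xs) = neg x ∷ negs xs

  negs : List Game → List Game
  negs [] = []
  negs (x ∷ xs) = neg x ∷ negs xs

-- Sum: integer sum for two numbers, otherwise
-- G + H = ⟨ G^L + H , G + H^L ∣ G^R + H , G + H^R ⟩  (numbers have no options).
mutual
  _⊞_ : Game → Game → Game
  num m ⊞ num n = num (m +ℤ n)
  num m ⊞ ⟨ hl ∣ hr ⟩ = ⟨ gAdd⁺ (num m) hl ∣ gAdd⁺ (num m) hr ⟩
  ⟨ gl ∣ gr ⟩ ⊞ num n = ⟨ addG⁺ gl (num n) ∣ addG⁺ gr (num n) ⟩
  ⟨ gl ∣ gr ⟩ ⊞ ⟨ hl ∣ hr ⟩ =
    ⟨ addG⁺ gl ⟨ hl ∣ hr ⟩ ⁺++⁺ gAdd⁺ ⟨ gl ∣ gr ⟩ hl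
    ∣ addG⁺ gr ⟨ hl ∣ hr ⟩ ⁺++⁺ gAdd⁺ ⟨ gl ∣ gr ⟩ hr ⟩

  addG⁺ : List⁺ Game → Game → List⁺ Game
  addG⁺ (x ∷ xs) h = (x ⊞ h) ∷ addGs xs h

  addGs : List Game → Game → List Game
  addGs [] h = []
  addGs (x ∷ xs) h = (x ⊞ h) ∷ addGs xs h

  gAdd⁺ : Game → List⁺ Game → List⁺ Game
  gAdd⁺ g (x ∷ xs) = (g ⊞ x) ∷ gAdds g xs

  gAdds : Game → List Game → List Game
  gAdds g [] = []
  gAdds g (x ∷ xs) = (g ⊞ x) ∷ gAdds g xs

data IGame : Game → Set where
  ig-num : ∀ n → IGame (num n)
  ig-opt : ∀ {ls rs} →
           (Even ⟨ ls ∣ rs ⟩ ⊎ Odd ⟨ ls ∣ rs ⟩) →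
           All IGame (toList ls) → All IGame (toList rs) →
           (Even ⟨ ls ∣ rs ⟩ → Ro ⟨ ls ∣ rs ⟩ ≤ Lo ⟨ ls ∣ rs ⟩) →
           IGame ⟨ ls ∣ rs ⟩

-- The two inequalities come from different places.
--  * L(G - G) ≤ 0 ≤ R(G - G) holds for every game: the second player answers
--    each move by the mirror move in the other component ("Tweedledum and
--    Tweedledee"); see mirror-Lo / mirror-Ro.
--  * R(G - G) ≤ L(G - G) needs i-games.  We prove Milnor-style translation
--    bounds for sums of i-games G, H (tempers s, t), by simultaneous induction:
--        L(G) + R(H) ≤ L(G + H)   unless G even, H odd,
--        R(G) + L(H) ≤ L(G + H)   unless G odd,  H even,
--        R(G) + R(H) ≤ R(G + H)   unless G, H both odd,
--    and, via negation (which distributes over sums), R(G + H) ≤ R(G) + L(H).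
--    For equal tempers this gives R(G + H) ≤ L(G + H), which is what makes
--    sums of i-games i-games again (igame-⊞).
module Submission where

open import Defs
open import Data.Empty using (⊥; ⊥-elim)
open import Data.Integer using (0ℤ; _+_; -_; _≤_; _⊔_; _⊓_)
open import Data.Integer.Properties
  using (≤-refl; ≤-reflexive; ≤-trans; ≤-antisym; +-monoˡ-≤; +-monoʳ-≤; +-inverseʳ;
         ⊔-sel; ⊓-sel; i≤i⊔j; i≤j⊔i; i⊓j≤i; i⊓j≤j; neg-mono-≤; neg-cancel-≤; neg-distrib-+;
         antimono-≤-distrib-⊓; antimono-≤-distrib-⊔; module ≤-Reasoning)
open import Data.List using (List; []; _∷_; _++_; map)
open import Data.List.NonEmpty using (List⁺; _∷_; toList; _⁺++⁺_)
open import Data.List.Properties using (++-identityʳ)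
open import Data.List.Relation.Unary.All as All using (All; []; _∷_)
open import Data.List.Relation.Unary.Any using (here; there)
open import Data.List.Membership.Propositional using (_∈_)
open import Data.List.Membership.Propositional.Properties using (∈-map⁺; ∈-map⁻; ∈-++⁺ˡ; ∈-++⁺ʳ; ∈-++⁻)
open import Data.Parity.Base using (Parity; 0ℙ; 1ℙ; _⁻¹) renaming (_+_ to _+ℙ_)
open import Data.Parity.Properties using (⁻¹-involutive) renaming (+-assoc to +ℙ-assoc)
open import Data.Product using (Σ; ∃-syntax; _×_; _,_)
open import Data.Sum using (inj₁; inj₂)
open import Data.Unit using (⊤; tt)
open import Relation.Binary.PropositionalEquality using (_≡_; refl; sym; trans; cong; cong₂; subst)

data Side : Set where
  left right : Side

opposite : Side → Side
opposite left  = right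
opposite right = left

Options : Side → Game → List Game
Options _     (num _)    = []
Options left  ⟨ ls ∣ _ ⟩ = toList ls
Options right ⟨ _ ∣ rs ⟩ = toList rs

options-All : ∀ {P : Game → Set} {ls rs} → All P (toList ls) → All P (toList rs) →
              ∀ side {x} → x ∈ Options side ⟨ ls ∣ rs ⟩ → P x
options-All pl pr left  = All.lookup pl
options-All pl pr right = All.lookup pr

game-ind : (P : Game → Set) →
           (∀ X → (∀ side {x} → x ∈ Options side X → P x) → P X) → ∀ X → P X
game-ind P step = ind
  where
  mutual
    ind : ∀ X → P X
    ind (num n)                = step (num n) (λ _ ())
    ind ⟨ l ∷ ls ∣ r ∷ rs ⟩ = step _ (options-All (ind-all l ls) (ind-all r rs))

    ind-all : ∀ x xs → All P (x ∷ xs)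
    ind-all x []       = ind x ∷ []
    ind-all x (y ∷ ys) = ind x ∷ ind-all y ys

game-ind₂ : (P : Game → Game → Set) →
            (∀ G H → (∀ side {x} → x ∈ Options side G → P x H) →
                     (∀ side {y} → y ∈ Options side H → P G y) → P G H) →
            ∀ G H → P G H
game-ind₂ P step =
  game-ind (λ G → ∀ H → P G H) λ G ihG →
    game-ind (P G) λ H ihH → step G H (λ side p → ihG side p H) ihH

addGs-map : ∀ xs h → addGs xs h ≡ map (_⊞ h) xs
addGs-map []       h = refl
addGs-map (x ∷ xs) h = cong ((x ⊞ h) ∷_) (addGs-map xs h)

gAdds-map : ∀ g xs → gAdds g xs ≡ map (g ⊞_) xs
gAdds-map g []       = refl
gAdds-map g (x ∷ xs) = cong ((g ⊞ x) ∷_) (gAdds-map g xs)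

negs-map : ∀ xs → negs xs ≡ map neg xs
negs-map []       = refl
negs-map (x ∷ xs) = cong (neg x ∷_) (negs-map xs)

addG⁺-map : ∀ xs h → toList (addG⁺ xs h) ≡ map (_⊞ h) (toList xs)
addG⁺-map (x ∷ xs) h = cong ((x ⊞ h) ∷_) (addGs-map xs h)

gAdd⁺-map : ∀ g xs → toList (gAdd⁺ g xs) ≡ map (g ⊞_) (toList xs)
gAdd⁺-map g (x ∷ xs) = cong ((g ⊞ x) ∷_) (gAdds-map g xs)

neg⁺-map : ∀ xs → toList (neg⁺ xs) ≡ map neg (toList xs)
neg⁺-map (x ∷ xs) = cong (neg x ∷_) (negs-map xs)

Options-⊞ : ∀ side G H →
            Options side (G ⊞ H) ≡ map (_⊞ H) (Options side G) ++ map (G ⊞_) (Options side H)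
Options-⊞ side  (num m)       (num n)       = refl
Options-⊞ left  (num m)       ⟨ hl ∣ _ ⟩    = gAdd⁺-map (num m) hl
Options-⊞ right (num m)       ⟨ _ ∣ hr ⟩    = gAdd⁺-map (num m) hr
Options-⊞ left  ⟨ gl ∣ _ ⟩    (num n)       = trans (addG⁺-map gl (num n)) (sym (++-identityʳ _))
Options-⊞ right ⟨ _ ∣ gr ⟩    (num n)       = trans (addG⁺-map gr (num n)) (sym (++-identityʳ _))
Options-⊞ left  G@(⟨ gl ∣ _ ⟩)  H@(⟨ hl ∣ _ ⟩)  = cong₂ _++_ (addG⁺-map gl H) (gAdd⁺-map G hl)
Options-⊞ right G@(⟨ _ ∣ gr ⟩)  H@(⟨ _ ∣ hr ⟩)  = cong₂ _++_ (addG⁺-map gr H) (gAdd⁺-map G hr)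

Options-neg : ∀ side G → Options side (neg G) ≡ map neg (Options (opposite side) G)
Options-neg side  (num n)      = refl
Options-neg left  ⟨ _ ∣ rs ⟩   = neg⁺-map rs
Options-neg right ⟨ ls ∣ _ ⟩   = neg⁺-map ls

∈-⊞ˡ : ∀ side G H {x} → x ∈ Options side G → (x ⊞ H) ∈ Options side (G ⊞ H)
∈-⊞ˡ side G H p = subst (_ ∈_) (sym (Options-⊞ side G H)) (∈-++⁺ˡ (∈-map⁺ (_⊞ H) p))

∈-⊞ʳ : ∀ side G H {y} → y ∈ Options side H → (G ⊞ y) ∈ Options side (G ⊞ H)
∈-⊞ʳ side G H p =
  subst (_ ∈_) (sym (Options-⊞ side G H)) (∈-++⁺ʳ (map (_⊞ H) (Options side G)) (∈-map⁺ (G ⊞_) p))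

∈-neg : ∀ side G {x} → x ∈ Options (opposite side) G → neg x ∈ Options side (neg G)
∈-neg side G p = subst (_ ∈_) (sym (Options-neg side G)) (∈-map⁺ neg p)

data SumOption (side : Side) (G H : Game) : Game → Set where
  fromˡ : ∀ {x} → x ∈ Options side G → SumOption side G H (x ⊞ H)
  fromʳ : ∀ {y} → y ∈ Options side H → SumOption side G H (G ⊞ y)

sum-option : ∀ side G H {z} → z ∈ Options side (G ⊞ H) → SumOption side G H z
sum-option side G H p with ∈-++⁻ (map (_⊞ H) (Options side G)) (subst (_ ∈_) (Options-⊞ side G H) p)
... | inj₁ q with ∈-map⁻ (_⊞ H) q
...   | _ , r , refl = fromˡ r
sum-option side G H p | inj₂ q with ∈-map⁻ (G ⊞_) q
...   | _ , r , refl = fromʳ r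

neg-option : ∀ side G {z} → z ∈ Options side (neg G) →
             ∃[ x ] x ∈ Options (opposite side) G × z ≡ neg x
neg-option side G p = ∈-map⁻ neg (subst (_ ∈_) (Options-neg side G) p)

data Compound : Game → Set where
  compound : ∀ {ls rs} → Compound ⟨ ls ∣ rs ⟩

compound-⊞ˡ : ∀ {G} H → Compound G → Compound (G ⊞ H)
compound-⊞ˡ (num _)   compound = compound
compound-⊞ˡ ⟨ _ ∣ _ ⟩ compound = compound

compound-⊞ʳ : ∀ G {H} → Compound H → Compound (G ⊞ H)
compound-⊞ʳ (num _)   compound = compound
compound-⊞ʳ ⟨ _ ∣ _ ⟩ compound = compound

compound-neg : ∀ {G} → Compound G → Compound (neg G)
compound-neg compound = compound

max-upper : ∀ l ls {x} → x ∈ l ∷ ls → Ro x ≤ maxRo l ls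
max-upper l []       (here refl) = ≤-refl
max-upper l (m ∷ ms) (here refl) = i≤i⊔j (Ro l) (maxRo m ms)
max-upper l (m ∷ ms) (there p)   = ≤-trans (max-upper m ms p) (i≤j⊔i (Ro l) (maxRo m ms))

max-attained : ∀ l ls → ∃[ x ] x ∈ l ∷ ls × maxRo l ls ≡ Ro x
max-attained l []       = l , here refl , refl
max-attained l (m ∷ ms) with ⊔-sel (Ro l) (maxRo m ms)
... | inj₁ max≡ = l , here refl , max≡
... | inj₂ max≡ with max-attained m ms
...   | x , p , max≡′ = x , there p , trans max≡ max≡′

min-lower : ∀ l ls {x} → x ∈ l ∷ ls → minLo l ls ≤ Lo x
min-lower l []       (here refl) = ≤-refl
min-lower l (m ∷ ms) (here refl) = i⊓j≤i (Lo l) (minLo m ms)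
min-lower l (m ∷ ms) (there p)   = ≤-trans (i⊓j≤j (Lo l) (minLo m ms)) (min-lower m ms p)

min-attained : ∀ l ls → ∃[ x ] x ∈ l ∷ ls × minLo l ls ≡ Lo x
min-attained l []       = l , here refl , refl
min-attained l (m ∷ ms) with ⊓-sel (Lo l) (minLo m ms)
... | inj₁ min≡ = l , here refl , min≡
... | inj₂ min≡ with min-attained m ms
...   | x , p , min≡′ = x , there p , trans min≡ min≡′

Lo-upper : ∀ X {x} → x ∈ Options left X → Ro x ≤ Lo X
Lo-upper (num n) ()
Lo-upper ⟨ l ∷ ls ∣ _ ⟩ p = max-upper l ls p

Lo-attained : ∀ X → Compound X → ∃[ x ] x ∈ Options left X × Lo X ≡ Ro x
Lo-attained ⟨ l ∷ ls ∣ _ ⟩ compound = max-attained l ls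

Ro-lower : ∀ X {x} → x ∈ Options right X → Ro X ≤ Lo x
Ro-lower (num n) ()
Ro-lower ⟨ _ ∣ r ∷ rs ⟩ p = min-lower r rs p

Ro-attained : ∀ X → Compound X → ∃[ x ] x ∈ Options right X × Ro X ≡ Lo x
Ro-attained ⟨ _ ∣ r ∷ rs ⟩ compound = min-attained r rs

Lo-least : ∀ X {c} → Compound X → (∀ {x} → x ∈ Options left X → Ro x ≤ c) → Lo X ≤ c
Lo-least X cX bound with Lo-attained X cX
... | x , p , Lo≡ = ≤-trans (≤-reflexive Lo≡) (bound p)

Ro-greatest : ∀ X {c} → Compound X → (∀ {x} → x ∈ Options right X → c ≤ Lo x) → c ≤ Ro X
Ro-greatest X cX bound with Ro-attained X cX
... | x , p , Ro≡ = ≤-trans (bound p) (≤-reflexive (sym Ro≡))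

mutual
  Lo-neg : ∀ G → Lo (neg G) ≡ - Ro G
  Lo-neg (num n)                     = refl
  Lo-neg ⟨ _ ∣ r ∷ rs ⟩ = neg-min r rs

  Ro-neg : ∀ G → Ro (neg G) ≡ - Lo G
  Ro-neg (num n)                     = refl
  Ro-neg ⟨ l ∷ ls ∣ _ ⟩ = neg-max l ls

  neg-min : ∀ r rs → maxRo (neg r) (negs rs) ≡ - minLo r rs
  neg-min r []       = Ro-neg r
  neg-min r (m ∷ ms) = trans (cong₂ _⊔_ (Ro-neg r) (neg-min m ms))
    (sym (antimono-≤-distrib-⊓ {f = -_} neg-mono-≤ (Lo r) (minLo m ms)))

  neg-max : ∀ l ls → minLo (neg l) (negs ls) ≡ - maxRo l ls
  neg-max l []       = Lo-neg l
  neg-max l (m ∷ ms) = trans (cong₂ _⊓_ (Lo-neg l) (neg-max m ms))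
    (sym (antimono-≤-distrib-⊔ {f = -_} neg-mono-≤ (Ro l) (maxRo m ms)))

negs-++ : ∀ xs ys → negs (xs ++ ys) ≡ negs xs ++ negs ys
negs-++ []       ys = refl
negs-++ (x ∷ xs) ys = cong (neg x ∷_) (negs-++ xs ys)

neg⁺-⁺++⁺ : ∀ xs ys → neg⁺ (xs ⁺++⁺ ys) ≡ neg⁺ xs ⁺++⁺ neg⁺ ys
neg⁺-⁺++⁺ (x ∷ xs) (y ∷ ys) = cong (neg x ∷_) (negs-++ xs (y ∷ ys))

mutual
  neg-⊞ : ∀ G H → neg (G ⊞ H) ≡ neg G ⊞ neg H
  neg-⊞ (num m) (num n) = cong num (neg-distrib-+ m n)
  neg-⊞ G@(num _) ⟨ hl ∣ hr ⟩ = cong₂ ⟨_∣_⟩ (neg-gAdd⁺ G hr) (neg-gAdd⁺ G hl)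
  neg-⊞ ⟨ gl ∣ gr ⟩ H@(num _) = cong₂ ⟨_∣_⟩ (neg-addG⁺ gr H) (neg-addG⁺ gl H)
  neg-⊞ G@(⟨ gl ∣ gr ⟩) H@(⟨ hl ∣ hr ⟩) = cong₂ ⟨_∣_⟩
    (trans (neg⁺-⁺++⁺ (addG⁺ gr H) (gAdd⁺ G hr)) (cong₂ _⁺++⁺_ (neg-addG⁺ gr H) (neg-gAdd⁺ G hr)))
    (trans (neg⁺-⁺++⁺ (addG⁺ gl H) (gAdd⁺ G hl)) (cong₂ _⁺++⁺_ (neg-addG⁺ gl H) (neg-gAdd⁺ G hl)))

  neg-addG⁺ : ∀ xs h → neg⁺ (addG⁺ xs h) ≡ addG⁺ (neg⁺ xs) (neg h)
  neg-addG⁺ (x ∷ xs) h = cong₂ _∷_ (neg-⊞ x h) (neg-addGs xs h)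

  neg-addGs : ∀ xs h → negs (addGs xs h) ≡ addGs (negs xs) (neg h)
  neg-addGs []       h = refl
  neg-addGs (x ∷ xs) h = cong₂ _∷_ (neg-⊞ x h) (neg-addGs xs h)

  neg-gAdd⁺ : ∀ g xs → neg⁺ (gAdd⁺ g xs) ≡ gAdd⁺ (neg g) (neg⁺ xs)
  neg-gAdd⁺ g (x ∷ xs) = cong₂ _∷_ (neg-⊞ g x) (neg-gAdds g xs)

  neg-gAdds : ∀ g xs → negs (gAdds g xs) ≡ gAdds (neg g) (negs xs)
  neg-gAdds g []       = refl
  neg-gAdds g (x ∷ xs) = cong₂ _∷_ (neg-⊞ g x) (neg-gAdds g xs)

-- Tempers as parities (0ℙ even, 1ℙ odd): options switch the temper and the
-- temper of a sum is the sum of the tempers.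
Tempered : Parity → Game → Set
Tempered 0ℙ = Even
Tempered 1ℙ = Odd

temper-option : ∀ side p {X x} → Tempered p X → x ∈ Options side X → Tempered (p ⁻¹) x
temper-option side 0ℙ (even-num n) ()
temper-option side 0ℙ (even-opt al ar) = options-All al ar side
temper-option side 1ℙ (odd-opt al ar)  = options-All al ar side

temper-intro : ∀ p X → (p ≡ 1ℙ → Compound X) →
               (∀ side {x} → x ∈ Options side X → Tempered (p ⁻¹) x) → Tempered p X
temper-intro 0ℙ (num n)       _ _    = even-num n
temper-intro 0ℙ ⟨ ls ∣ rs ⟩   _ opts = even-opt (All.tabulate (opts left)) (All.tabulate (opts right))
temper-intro 1ℙ (num n)       c _    with c refl
... | ()
temper-intro 1ℙ ⟨ ls ∣ rs ⟩   _ opts = odd-opt (All.tabulate (opts left)) (All.tabulate (opts right))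

even-not-odd : ∀ {X} → Even X → Odd X → ⊥
even-not-odd (even-opt (o ∷ _) _) (odd-opt (e ∷ _) _) = even-not-odd e o

odd-compound : ∀ {X} → Odd X → Compound X
odd-compound (odd-opt _ _) = compound

⁻¹-+ℙ : ∀ s t → s ⁻¹ +ℙ t ≡ (s +ℙ t) ⁻¹
⁻¹-+ℙ = +ℙ-assoc 1ℙ

+ℙ-⁻¹ : ∀ s t → s +ℙ t ⁻¹ ≡ (s +ℙ t) ⁻¹
+ℙ-⁻¹ 0ℙ t = refl
+ℙ-⁻¹ 1ℙ t = refl

sum-compound : ∀ {G H} s t → Tempered s G → Tempered t H → s +ℙ t ≡ 1ℙ → Compound (G ⊞ H)
sum-compound {H = H} 1ℙ t  tG _  _ = compound-⊞ˡ H (odd-compound tG)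
sum-compound {G = G} 0ℙ 1ℙ _  tH _ = compound-⊞ʳ G (odd-compound tH)

temper-⊞ : ∀ G H s t → Tempered s G → Tempered t H → Tempered (s +ℙ t) (G ⊞ H)
temper-⊞ = game-ind₂ _ step
  where
  step : ∀ G H →
         (∀ side {x} → x ∈ Options side G →
            ∀ s t → Tempered s x → Tempered t H → Tempered (s +ℙ t) (x ⊞ H)) →
         (∀ side {y} → y ∈ Options side H →
            ∀ s t → Tempered s G → Tempered t y → Tempered (s +ℙ t) (G ⊞ y)) →
         ∀ s t → Tempered s G → Tempered t H → Tempered (s +ℙ t) (G ⊞ H)
  step G H ihG ihH s t tG tH = temper-intro (s +ℙ t) (G ⊞ H) (sum-compound s t tG tH) opts
    where
    opts : ∀ side {z} → z ∈ Options side (G ⊞ H) → Tempered ((s +ℙ t) ⁻¹) z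
    opts side p with sum-option side G H p
    ... | fromˡ q = subst (λ u → Tempered u _) (⁻¹-+ℙ s t)
                      (ihG side q (s ⁻¹) t (temper-option side s tG q) tH)
    ... | fromʳ q = subst (λ u → Tempered u _) (+ℙ-⁻¹ s t)
                      (ihH side q s (t ⁻¹) tG (temper-option side t tH q))

temper-neg : ∀ G p → Tempered p G → Tempered p (neg G)
temper-neg = game-ind _ step
  where
  step : ∀ G → (∀ side {x} → x ∈ Options side G → ∀ p → Tempered p x → Tempered p (neg x)) →
         ∀ p → Tempered p G → Tempered p (neg G)
  step G ih p tG = temper-intro p (neg G) (λ { refl → compound-neg (odd-compound tG) }) opts
    where
    opts : ∀ side {z} → z ∈ Options side (neg G) → Tempered (p ⁻¹) z
    opts side q with neg-option side G q
    ... | x , r , refl = ih (opposite side) r (p ⁻¹) (temper-option (opposite side) p tG r)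

even-of-neg : ∀ p {G} → Tempered p G → Even (neg G) → Even G
even-of-neg 0ℙ tG _ = tG
even-of-neg 1ℙ tG e = ⊥-elim (even-not-odd e (temper-neg _ 1ℙ tG))

igame-temper : ∀ {X} → IGame X → Σ Parity λ p → Tempered p X
igame-temper (ig-num n)               = 0ℙ , even-num n
igame-temper (ig-opt (inj₁ e) _ _ _) = 0ℙ , e
igame-temper (ig-opt (inj₂ o) _ _ _) = 1ℙ , o

igame-option : ∀ side {X x} → IGame X → x ∈ Options side X → IGame x
igame-option side (ig-num n) ()
igame-option side (ig-opt _ al ar _) = options-All al ar side

igame-even : ∀ {X} → IGame X → Even X → Ro X ≤ Lo X
igame-even (ig-num n)        _ = ≤-refl
igame-even (ig-opt _ _ _ RL) e = RL e

igame-intro : ∀ p X → Tempered p X → (∀ side {x} → x ∈ Options side X → IGame x) →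
              (Even X → Ro X ≤ Lo X) → IGame X
igame-intro p  (num n)     _  _    _  = ig-num n
igame-intro 0ℙ ⟨ ls ∣ rs ⟩ tX opts RL =
  ig-opt (inj₁ tX) (All.tabulate (opts left)) (All.tabulate (opts right)) RL
igame-intro 1ℙ ⟨ ls ∣ rs ⟩ tX opts RL =
  ig-opt (inj₂ tX) (All.tabulate (opts left)) (All.tabulate (opts right)) RL

igame-neg : ∀ {G} → IGame G → IGame (neg G)
igame-neg {G} = game-ind (λ G → IGame G → IGame (neg G)) step G
  where
  step : ∀ G → (∀ side {x} → x ∈ Options side G → IGame x → IGame (neg x)) → IGame G → IGame (neg G)
  step G ih iG with igame-temper iG
  ... | p , tG = igame-intro p (neg G) (temper-neg G p tG) opts RL
    where
    opts : ∀ side {z} → z ∈ Options side (neg G) → IGame z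
    opts side q with neg-option side G q
    ... | x , r , refl = ih (opposite side) r (igame-option (opposite side) iG r)
    RL : Even (neg G) → Ro (neg G) ≤ Lo (neg G)
    RL e = begin
      Ro (neg G)  ≡⟨ Ro-neg G ⟩
      - Lo G      ≤⟨ neg-mono-≤ (igame-even iG (even-of-neg p tG e)) ⟩
      - Ro G      ≡⟨ sym (Lo-neg G) ⟩
      Lo (neg G)  ∎
      where open ≤-Reasoning

-- The excluded case of the R + R bound; the other two bounds exclude the
-- combinations obtained by switching one temper.
NotBothOdd : Parity → Parity → Set
NotBothOdd 1ℙ 1ℙ = ⊥
NotBothOdd _  _  = ⊤

record SumBounds (G H : Game) : Set where
  field
    -- unless G even and H odd
    LR≤L : ∀ s t → Tempered s G → Tempered t H → NotBothOdd (s ⁻¹) t → Lo G + Ro H ≤ Lo (G ⊞ H)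
    -- unless G odd and H even
    RL≤L : ∀ s t → Tempered s G → Tempered t H → NotBothOdd s (t ⁻¹) → Ro G + Lo H ≤ Lo (G ⊞ H)
    -- unless G and H both odd
    RR≤R : ∀ s t → Tempered s G → Tempered t H → NotBothOdd s t → Ro G + Ro H ≤ Ro (G ⊞ H)
open SumBounds

module SumBoundsStep (G H : Game)
  (ihG : ∀ side {x} → x ∈ Options side G → SumBounds x H)
  (ihH : ∀ side {y} → y ∈ Options side H → SumBounds G y) where
  open ≤-Reasoning

  -- Left plays the best move x in G: L(G) + R(H) = R(x) + R(H) ≤ R(x + H) ≤ L(G + H).
  LR≤L-compound : Compound G → ∀ s t → Tempered s G → Tempered t H → NotBothOdd (s ⁻¹) t →
                  Lo G + Ro H ≤ Lo (G ⊞ H)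
  LR≤L-compound cG s t tG tH ok with Lo-attained G cG
  ... | x , p , Lo≡ = begin
    Lo G + Ro H  ≡⟨ cong (_+ Ro H) Lo≡ ⟩
    Ro x + Ro H  ≤⟨ RR≤R (ihG left p) (s ⁻¹) t (temper-option left s tG p) tH ok ⟩
    Ro (x ⊞ H)   ≤⟨ Lo-upper (G ⊞ H) (∈-⊞ˡ left G H p) ⟩
    Lo (G ⊞ H)   ∎

  -- Left plays the best move y in H: R(G) + L(H) = R(G) + R(y) ≤ R(G + y) ≤ L(G + H).
  RL≤L-compound : Compound H → ∀ s t → Tempered s G → Tempered t H → NotBothOdd s (t ⁻¹) →
                  Ro G + Lo H ≤ Lo (G ⊞ H)
  RL≤L-compound cH s t tG tH ok with Lo-attained H cH
  ... | y , p , Lo≡ = begin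
    Ro G + Lo H  ≡⟨ cong (Ro G +_) Lo≡ ⟩
    Ro G + Ro y  ≤⟨ RR≤R (ihH left p) s (t ⁻¹) tG (temper-option left t tH p) ok ⟩
    Ro (G ⊞ y)   ≤⟨ Lo-upper (G ⊞ H) (∈-⊞ʳ left G H p) ⟩
    Lo (G ⊞ H)   ∎

  -- Every Right move of G + H is in G or in H, and each is bounded below by R(G) + R(H).
  RR≤R-compound : Compound (G ⊞ H) → ∀ s t → Tempered s G → Tempered t H → NotBothOdd s t →
                  Ro G + Ro H ≤ Ro (G ⊞ H)
  RR≤R-compound c s t tG tH ok = Ro-greatest (G ⊞ H) c (λ p → bound (sum-option right G H p))
    where
    bound : ∀ {z} → SumOption right G H z → Ro G + Ro H ≤ Lo z
    bound (fromˡ {x} q) = begin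
      Ro G + Ro H  ≤⟨ +-monoˡ-≤ (Ro H) (Ro-lower G q) ⟩
      Lo x + Ro H  ≤⟨ LR≤L (ihG right q) (s ⁻¹) t (temper-option right s tG q) tH
                          (subst (λ u → NotBothOdd u t) (sym (⁻¹-involutive s)) ok) ⟩
      Lo (x ⊞ H)   ∎
    bound (fromʳ {y} q) = begin
      Ro G + Ro H  ≤⟨ +-monoʳ-≤ (Ro G) (Ro-lower H q) ⟩
      Ro G + Lo y  ≤⟨ RL≤L (ihH right q) s (t ⁻¹) tG (temper-option right t tH q)
                          (subst (NotBothOdd s) (sym (⁻¹-involutive t)) ok) ⟩
      Lo (G ⊞ y)   ∎

-- A number component is even, and then (by the side condition) so is the
-- other one; its inequality R ≤ L reduces the missing bound to the other bound.
sum-bounds-step : ∀ G H → IGame G → IGame H →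
                  (∀ side {x} → x ∈ Options side G → SumBounds x H) →
                  (∀ side {y} → y ∈ Options side H → SumBounds G y) → SumBounds G H
sum-bounds-step (num m) (num n) _ _ _ _ = record
  { LR≤L = λ _ _ _ _ _ → ≤-refl ; RL≤L = λ _ _ _ _ _ → ≤-refl ; RR≤R = λ _ _ _ _ _ → ≤-refl }
sum-bounds-step G@(⟨ _ ∣ _ ⟩) H@(num n) iG _ ihG ihH = record
  { LR≤L = LR≤L-compound compound
  ; RL≤L = λ { 0ℙ 0ℙ tG tH _ → ≤-trans (+-monoˡ-≤ n (igame-even iG tG))
                                         (LR≤L-compound compound 0ℙ 0ℙ tG tH tt)
             ; 1ℙ 0ℙ _  _  () }
  ; RR≤R = RR≤R-compound compound }
  where open SumBoundsStep G H ihG ihH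
sum-bounds-step G@(num m) H@(⟨ _ ∣ _ ⟩) _ iH ihG ihH = record
  { LR≤L = λ { 0ℙ 0ℙ tG tH _ → ≤-trans (+-monoʳ-≤ m (igame-even iH tH))
                                         (RL≤L-compound compound 0ℙ 0ℙ tG tH tt)
             ; 0ℙ 1ℙ _  _  () }
  ; RL≤L = RL≤L-compound compound
  ; RR≤R = RR≤R-compound compound }
  where open SumBoundsStep G H ihG ihH
sum-bounds-step G@(⟨ _ ∣ _ ⟩) H@(⟨ _ ∣ _ ⟩) _ _ ihG ihH = record
  { LR≤L = LR≤L-compound compound ; RL≤L = RL≤L-compound compound ; RR≤R = RR≤R-compound compound }
  where open SumBoundsStep G H ihG ihH

sum-bounds : ∀ G H → IGame G → IGame H → SumBounds G H
sum-bounds = game-ind₂ (λ G H → IGame G → IGame H → SumBounds G H) λ G H ihG ihH iG iH →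
  sum-bounds-step G H iG iH (λ side p → ihG side p (igame-option side iG p) iH)
                            (λ side p → ihH side p iG (igame-option side iH p))

-- The dual bound R(G + H) ≤ R(G) + L(H) (unless G even, H odd), by applying
-- LR≤L to -G, -H.
R≤RL : ∀ G H → IGame G → IGame H → ∀ s t → Tempered s G → Tempered t H → NotBothOdd (s ⁻¹) t →
       Ro (G ⊞ H) ≤ Ro G + Lo H
R≤RL G H iG iH s t tG tH ok = neg-cancel-≤ (begin
  - (Ro G + Lo H)           ≡⟨ neg-distrib-+ (Ro G) (Lo H) ⟩
  - Ro G + - Lo H           ≡⟨ sym (cong₂ _+_ (Lo-neg G) (Ro-neg H)) ⟩
  Lo (neg G) + Ro (neg H)   ≤⟨ LR≤L (sum-bounds (neg G) (neg H) (igame-neg iG) (igame-neg iH))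
                                    s t (temper-neg G s tG) (temper-neg H t tH) ok ⟩
  Lo (neg G ⊞ neg H)        ≡⟨ cong Lo (sym (neg-⊞ G H)) ⟩
  Lo (neg (G ⊞ H))          ≡⟨ Lo-neg (G ⊞ H) ⟩
  - Ro (G ⊞ H)              ∎)
  where open ≤-Reasoning

-- For i-games of equal temper, R(G + H) ≤ R(G) + L(H) ≤ L(G + H).
R≤L-same-temper : ∀ G H → IGame G → IGame H → ∀ s → Tempered s G → Tempered s H →
                  Ro (G ⊞ H) ≤ Lo (G ⊞ H)
R≤L-same-temper G H iG iH s tG tH =
  ≤-trans (R≤RL G H iG iH s s tG tH (switched s)) (RL≤L (sum-bounds G H iG iH) s s tG tH (switched′ s))
  where
  switched : ∀ s → NotBothOdd (s ⁻¹) s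
  switched 0ℙ = tt
  switched 1ℙ = tt
  switched′ : ∀ s → NotBothOdd s (s ⁻¹)
  switched′ 0ℙ = tt
  switched′ 1ℙ = tt

-- An even sum of i-games satisfies R ≤ L, since its summands have equal temper.
sum-even-R≤L : ∀ G H → IGame G → IGame H → Even (G ⊞ H) → Ro (G ⊞ H) ≤ Lo (G ⊞ H)
sum-even-R≤L G H iG iH e with igame-temper iG | igame-temper iH
... | 0ℙ , tG | 0ℙ , tH = R≤L-same-temper G H iG iH 0ℙ tG tH
... | 1ℙ , tG | 1ℙ , tH = R≤L-same-temper G H iG iH 1ℙ tG tH
... | 0ℙ , tG | 1ℙ , tH = ⊥-elim (even-not-odd e (temper-⊞ G H 0ℙ 1ℙ tG tH))
... | 1ℙ , tG | 0ℙ , tH = ⊥-elim (even-not-odd e (temper-⊞ G H 1ℙ 0ℙ tG tH))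

igame-⊞ : ∀ G H → IGame G → IGame H → IGame (G ⊞ H)
igame-⊞ = game-ind₂ (λ G H → IGame G → IGame H → IGame (G ⊞ H)) step
  where
  step : ∀ G H → (∀ side {x} → x ∈ Options side G → IGame x → IGame H → IGame (x ⊞ H)) →
                 (∀ side {y} → y ∈ Options side H → IGame G → IGame y → IGame (G ⊞ y)) →
                 IGame G → IGame H → IGame (G ⊞ H)
  step G H ihG ihH iG iH with igame-temper iG | igame-temper iH
  ... | s , tG | t , tH = igame-intro (s +ℙ t) (G ⊞ H) (temper-⊞ G H s t tG tH) opts (sum-even-R≤L G H iG iH)
    where
    opts : ∀ side {z} → z ∈ Options side (G ⊞ H) → IGame z
    opts side p with sum-option side G H p
    ... | fromˡ q = ihG side q (igame-option side iG q) iH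
    ... | fromʳ q = ihH side q iG (igame-option side iH q)

-- The mirror strategy, valid for every game: each Left move in G - G is
-- answered by the mirror Right move, giving some x - x; dually for Right.
mirror-Lo : ∀ G → Lo (G ⊞ neg G) ≤ 0ℤ
mirror-Lo = game-ind _ step
  where
  step : ∀ G → (∀ side {x} → x ∈ Options side G → Lo (x ⊞ neg x) ≤ 0ℤ) → Lo (G ⊞ neg G) ≤ 0ℤ
  step (num n)       _  = ≤-reflexive (+-inverseʳ n)
  step G@(⟨ _ ∣ _ ⟩) ih = Lo-least (G ⊞ neg G) compound reply
    where
    reply : ∀ {z} → z ∈ Options left (G ⊞ neg G) → Ro z ≤ 0ℤ
    reply p with sum-option left G (neg G) p
    ... | fromˡ {x} q = ≤-trans (Ro-lower (x ⊞ neg G) (∈-⊞ʳ right x (neg G) (∈-neg right G q))) (ih left q)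
    ... | fromʳ q with neg-option left G q
    ...   | w , r , refl = ≤-trans (Ro-lower (G ⊞ neg w) (∈-⊞ˡ right G (neg w) r)) (ih right r)

mirror-Ro : ∀ G → 0ℤ ≤ Ro (G ⊞ neg G)
mirror-Ro = game-ind _ step
  where
  step : ∀ G → (∀ side {x} → x ∈ Options side G → 0ℤ ≤ Ro (x ⊞ neg x)) → 0ℤ ≤ Ro (G ⊞ neg G)
  step (num n)       _  = ≤-reflexive (sym (+-inverseʳ n))
  step G@(⟨ _ ∣ _ ⟩) ih = Ro-greatest (G ⊞ neg G) compound reply
    where
    reply : ∀ {z} → z ∈ Options right (G ⊞ neg G) → 0ℤ ≤ Lo z
    reply p with sum-option right G (neg G) p
    ... | fromˡ {x} q = ≤-trans (ih right q) (Lo-upper (x ⊞ neg G) (∈-⊞ʳ left x (neg G) (∈-neg left G q)))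
    ... | fromʳ q with neg-option right G q
    ...   | w , r , refl = ≤-trans (ih left r) (Lo-upper (G ⊞ neg w) (∈-⊞ˡ left G (neg w) r))

mainTheorem5 : (G : Game) → IGame G →
    IGame (G ⊞ neg G) × Lo (G ⊞ neg G) ≡ 0ℤ × Ro (G ⊞ neg G) ≡ 0ℤ
mainTheorem5 G iG =
  igame-⊞ G (neg G) iG iN ,
  ≤-antisym L≤0 (≤-trans 0≤R R≤L) ,
  ≤-antisym (≤-trans R≤L L≤0) 0≤R
  where
  iN : IGame (neg G)
  iN = igame-neg iG
  L≤0 : Lo (G ⊞ neg G) ≤ 0ℤ
  L≤0 = mirror-Lo G
  0≤R : 0ℤ ≤ Ro (G ⊞ neg G)
  0≤R = mirror-Ro G
  R≤L : Ro (G ⊞ neg G) ≤ Lo (G ⊞ neg G)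
  R≤L with igame-temper iG
  ... | s , tG = R≤L-same-temper G (neg G) iG iN s tG (temper-neg G s tG)
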